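{- Let $r\geq 3$ and $\Delta\geq 1$ be integers, and let $G$ be an $r$-uniform hypergraph with maximum degree $\Delta$. Then $$\chi_{\mathrm{ch}}(G)\leq c:=\left\lceil \Big(\frac{r-1}{r-2}\Big)\big((r-2)\Delta\big)^{1/(r-1)}\right\rceil.$$ Moreover, for every $c$-list-assignment $L$ of $G$, the number $P(G,L)$ of proper $L$-colourings of $G$ satisfies $$P(G,L)\geq \big((r-2)\Delta\big)^{|V(G)|/(r-1)}.$$
   Context: All hypergraphs are finite. A hypergraph $G$ consists of a vertex set $V(G)$ and a set $E(G)$ of edges, each a subset of $V(G)$; it is $r$-uniform if every edge has exactly $r$ vertices. The degree of a vertex is the number of edges containing it. A list-assignment $L$ of $G$ assigns to each vertex $v$ a set $L(v)$ of colours; it is a $c$-list-assignment if $|L(v)|=c$ for all $v$. An $L$-colouring is a function $\phi$ on $V(G)$ with $\phi(v)\in L(v)$ for all $v$. A colouring is proper if no edge is monochromatic. The choosability $\chi_{\mathrm{ch}}(G)$ is the minimum integer $c$ such that $G$ has a proper $L$-colouring for every $c$-list-assignment $L$. -}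

module Defs where

open import Data.Nat using (ℕ; zero; suc; _+_; _*_; _∸_; _^_; _≤_; _≥_)
open import Data.Nat.Properties using (_≟_)
open import Data.Fin using (Fin; zero; suc)
import Data.Fin.Properties as FinP
open import Data.Fin.Subset using (Subset; _∈_; ∣_∣)
open import Data.Fin.Subset.Properties using (_∈?_)
open import Data.List using (List; []; _∷_; length; filter; map; concatMap; [_])
open import Data.List.Relation.Unary.All using (All)
import Data.List.Relation.Unary.All as All
open import Data.List.Relation.Unary.Unique.Propositional using (Unique)
import Data.List.Membership.Propositional as ListMem
open import Data.Product using (Σ; _×_; _,_; ∃)
open import Relation.Nullary using (¬_; Dec; ¬?)
open import Relation.Nullary.Decidable using (_→-dec_)
open import Relation.Binary.PropositionalEquality using (_≡_)

record Hypergraph (n : ℕ) : Set where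
  field
    edges       : List (Subset n)
    edgesUnique : Unique edges
open Hypergraph public

Uniform : ∀ {n} → ℕ → Hypergraph n → Set
Uniform r G = All (λ e → ∣ e ∣ ≡ r) (edges G)

degree : ∀ {n} → Hypergraph n → Fin n → ℕ
degree G v = length (filter (λ e → v ∈? e) (edges G))

MaxDegree : ∀ {n} → Hypergraph n → ℕ → Set
MaxDegree {n} G Δ = (∀ v → degree G v ≤ Δ) × (∃ λ v → degree G v ≡ Δ)

ListAssignment : ℕ → Set
ListAssignment n = Fin n → List ℕ

IsCListAssignment : ∀ {n} → ℕ → ListAssignment n → Set
IsCListAssignment c L = ∀ v → Unique (L v) × length (L v) ≡ c

IsLColouring : ∀ {n} → ListAssignment n → (Fin n → ℕ) → Set
IsLColouring L φ = ∀ v → ListMem._∈_ (φ v) (L v)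

Monochromatic : ∀ {n} → (Fin n → ℕ) → Subset n → Set
Monochromatic φ e = ∀ u w → u ∈ e → w ∈ e → φ u ≡ φ w

monochromatic? : ∀ {n} (φ : Fin n → ℕ) (e : Subset n) → Dec (Monochromatic φ e)
monochromatic? φ e =
  FinP.all? λ u → FinP.all? λ w → (u ∈? e) →-dec ((w ∈? e) →-dec (φ u ≟ φ w))

Proper : ∀ {n} → Hypergraph n → (Fin n → ℕ) → Set
Proper G φ = All (λ e → ¬ Monochromatic φ e) (edges G)

proper? : ∀ {n} (G : Hypergraph n) (φ : Fin n → ℕ) → Dec (Proper G φ)
proper? G φ = All.all? (λ e → ¬? (monochromatic? φ e)) (edges G)

Choosable : ∀ {n} → Hypergraph n → ℕ → Set
Choosable {n} G c = ∀ (L : ListAssignment n) → IsCListAssignment c L →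
  Σ (Fin n → ℕ) λ φ → IsLColouring L φ × Proper G φ

ChoosabilityAtMost : ∀ {n} → Hypergraph n → ℕ → Set
ChoosabilityAtMost G c = ∃ λ c' → c' ≤ c × Choosable G c'

cons : ∀ {n} → ℕ → (Fin n → ℕ) → Fin (suc n) → ℕ
cons a f zero    = a
cons a f (suc i) = f i

lColourings : ∀ n → ListAssignment n → List (Fin n → ℕ)
lColourings zero    L = [ (λ ()) ]
lColourings (suc n) L =
  concatMap (λ a → map (cons a) (lColourings n (λ i → L (suc i)))) (L zero)

P : ∀ {n} → Hypergraph n → ListAssignment n → ℕ
P {n} G L = length (filter (proper? G) (lColourings n L))

-- c = ⌈ ((r-1)/(r-2)) ((r-2)Δ)^{1/(r-1)} ⌉ characterised in ℕ (for r ≥ 3):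
-- for a natural k, k ≥ ((r-1)/(r-2)) ((r-2)Δ)^{1/(r-1)}
--   ⇔ (k (r-2))^{r-1} ≥ (r-2) Δ (r-1)^{r-1}.
AboveBound : ℕ → ℕ → ℕ → Set
AboveBound r Δ k = (k * (r ∸ 2)) ^ (r ∸ 1) ≥ (r ∸ 2) * Δ * (r ∸ 1) ^ (r ∸ 1)

IsCeilBound : ℕ → ℕ → ℕ → Set
IsCeilBound r Δ c = AboveBound r Δ c × (∀ k → AboveBound r Δ k → c ≤ k)

{-# OPTIONS --safe #-}
-- Write r = k + 2.  For a set S of vertices let P[ S ] count the L-colourings of S that are
-- proper on the edges inside S.  The heart of the proof is the bound c k P[ S - v ] ≤ (k + 1) P[ S ]
-- for v ∈ S, by induction on S.  Of the c ways to extend a proper colouring of S - v to v, each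
-- failure makes some edge e ∋ v monochromatic.  Such a colouring is determined by its restriction
-- to S minus v and k further vertices of e, which all copy the colour of the last vertex of e; so
-- by the induction hypothesis there are at most ((k + 1) / (c k))^k P[ S - v ] of them.  Summing
-- over the at most Δ edges at v and using Δ (k + 1)^(k + 1) ≤ c (c k)^k, the defining property of
-- c, gives the bound.  Deleting the vertices one by one yields P(G, L) ≥ (c k / (k + 1))^n, whence
-- P(G, L)^(k + 1) ≥ (k Δ)^n; in particular P(G, L) > 0.

module Submission where

open import Defs
open import Data.Nat
  using (ℕ; zero; suc; _+_; _*_; _^_; _∸_; _≤_; _≥_; z≤n; s≤s; _≟_; NonZero; ≢-nonZero; >-nonZero)
open import Data.Nat.Properties
open import Algebra.Properties.CommutativeSemigroup +-commutativeSemigroup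
  using () renaming (interchange to +-interchange)
open import Algebra.Properties.CommutativeSemigroup *-commutativeSemigroup
  using (x∙yz≈y∙xz) renaming (interchange to *-interchange)
open import Data.Nat.ListAction using (sum)
open import Data.Nat.ListAction.Properties using (sum-++)
open import Data.Fin using (Fin; zero; suc)
import Data.Fin.Properties as Fin
open import Data.Fin.Subset
open import Data.Fin.Subset.Properties
  using (_∈?_; _⊆?_; ∈⊤; ∉⊥; ⊆-refl; ⊆-⊂-trans; p─⊥≡p; p─q⊆p; x∈⁅x⁆; x∈p∧x≢y⇒x∈p-y; x∈p⇒p-x⊂p;
         p⊆q⇒∣p∣≤∣q∣; ∣⊥∣≡0; Empty-unique)
open import Data.Fin.Subset.Induction using (⊂-wellFounded)
open import Data.Vec using ([]; _∷_; here; there)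
open import Data.Vec.Functional using (Vector; updateAt)
open import Data.Vec.Functional.Properties using (updateAt-updates; updateAt-minimal)
open import Data.List using (List; []; _∷_; [_]; _++_; length; map; concatMap; filter; foldl; allFin)
open import Data.List.Properties using (map-cong; map-++; map-∘; length-map; length-++-≤ˡ; length-tabulate)
open import Data.List.Relation.Unary.All as All using (All; []; _∷_)
open import Data.List.Relation.Unary.Any as Any using (Any; here; there)
open import Data.List.Relation.Unary.AllPairs as AllPairs using ([]; _∷_)
open import Data.List.Relation.Unary.Unique.Propositional using (Unique)
import Data.List.Relation.Unary.Unique.Propositional.Properties as Unique
import Data.List.Membership.Propositional as List
open import Data.List.Membership.Propositional using (find; lose)
open import Data.List.Membership.Propositional.Properties
  using (∈-map⁻; ∈-concatMap⁻; ∈-filter⁺; ∈-filter⁻; ∈-allFin)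
open import Data.Product using (Σ; ∃₂; _×_; _,_; proj₁; proj₂)
open import Data.Sum using (_⊎_; inj₁; inj₂)
open import Function using (_∘_; id; const)
import Induction.WellFounded as WF
open import Relation.Nullary using (¬_; Dec; yes; no; ¬?; contradiction)
open import Relation.Nullary.Decidable using (_×-dec_; _→-dec_; decidable-stable; toSum)
open import Relation.Unary using (Decidable)
open import Relation.Binary.PropositionalEquality hiding ([_])

-- Sums and counting over lists

𝟙 : {P : Set} → Dec P → ℕ
𝟙 (yes _) = 1
𝟙 (no _)  = 0

𝟙-mono : {P Q : Set} (p : Dec P) (q : Dec Q) → (P → Q) → 𝟙 p ≤ 𝟙 q
𝟙-mono (yes _) (yes _) _   = ≤-refl
𝟙-mono (yes p) (no ¬q) P⇒Q = contradiction (P⇒Q p) ¬q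
𝟙-mono (no _)  _       _   = z≤n

𝟙-cong : {P Q : Set} (p : Dec P) (q : Dec Q) → (P → Q) → (Q → P) → 𝟙 p ≡ 𝟙 q
𝟙-cong p q P⇒Q Q⇒P = ≤-antisym (𝟙-mono p q P⇒Q) (𝟙-mono q p Q⇒P)

1≤𝟙 : {P : Set} (p : Dec P) → P → 1 ≤ 𝟙 p
1≤𝟙 (yes _) _  = ≤-refl
1≤𝟙 (no ¬p) p = contradiction p ¬p

module _ {A : Set} where

  ∑ : List A → (A → ℕ) → ℕ
  ∑ xs f = sum (map f xs)

  syntax ∑ xs (λ x → t) = ∑[ x ∈ xs ] t

  ∑-cong : ∀ {f g : A → ℕ} xs → (∀ x → f x ≡ g x) → ∑ xs f ≡ ∑ xs g
  ∑-cong xs f≗g = cong sum (map-cong f≗g xs)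

  ∑-mono : ∀ {f g : A → ℕ} xs → (∀ {x} → x List.∈ xs → f x ≤ g x) → ∑ xs f ≤ ∑ xs g
  ∑-mono []       f≤g = z≤n
  ∑-mono (x ∷ xs) f≤g = +-mono-≤ (f≤g (here refl)) (∑-mono xs (f≤g ∘ there))

  ∑-+ : ∀ (f g : A → ℕ) xs → ∑[ x ∈ xs ] (f x + g x) ≡ ∑ xs f + ∑ xs g
  ∑-+ f g []       = refl
  ∑-+ f g (x ∷ xs) = trans (cong (f x + g x +_) (∑-+ f g xs)) (+-interchange (f x) (g x) _ _)

  ∑-*ˡ : ∀ a (f : A → ℕ) xs → ∑[ x ∈ xs ] (a * f x) ≡ a * ∑ xs f
  ∑-*ˡ a f []       = sym (*-zeroʳ a)
  ∑-*ˡ a f (x ∷ xs) = trans (cong (a * f x +_) (∑-*ˡ a f xs)) (sym (*-distribˡ-+ a (f x) _))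

  ∑-const : ∀ a (xs : List A) → ∑[ x ∈ xs ] a ≡ length xs * a
  ∑-const a []       = refl
  ∑-const a (x ∷ xs) = cong (a +_) (∑-const a xs)

  ∑-++ : ∀ (f : A → ℕ) xs ys → ∑ (xs ++ ys) f ≡ ∑ xs f + ∑ ys f
  ∑-++ f xs ys = trans (cong sum (map-++ f xs ys)) (sum-++ (map f xs) (map f ys))

module _ {A B : Set} where

  ∑-map : ∀ (f : B → ℕ) (g : A → B) xs → ∑ (map g xs) f ≡ ∑[ x ∈ xs ] f (g x)
  ∑-map f g xs = cong sum (sym (map-∘ xs))

  ∑-concatMap : ∀ (f : B → ℕ) (g : A → List B) xs →
                ∑ (concatMap g xs) f ≡ ∑[ x ∈ xs ] ∑ (g x) f
  ∑-concatMap f g []       = refl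
  ∑-concatMap f g (x ∷ xs) =
    trans (∑-++ f (g x) (concatMap g xs)) (cong (∑ (g x) f +_) (∑-concatMap f g xs))

  ∑-comm : ∀ (f : A → B → ℕ) xs ys → ∑[ x ∈ xs ] ∑[ y ∈ ys ] f x y ≡ ∑[ y ∈ ys ] ∑[ x ∈ xs ] f x y
  ∑-comm f []       ys = sym (trans (∑-const 0 ys) (*-zeroʳ (length ys)))
  ∑-comm f (x ∷ xs) ys =
    trans (cong (∑ ys (f x) +_) (∑-comm f xs ys)) (sym (∑-+ (f x) (λ y → ∑[ x ∈ xs ] f x y) ys))

module _ {A : Set} {P : A → Set} (P? : Decidable P) where

  count : List A → ℕ
  count xs = ∑[ x ∈ xs ] 𝟙 (P? x)

  length-filter≡count : ∀ xs → length (filter P? xs) ≡ count xs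
  length-filter≡count []       = refl
  length-filter≡count (x ∷ xs) with P? x
  ... | yes _ = cong suc (length-filter≡count xs)
  ... | no  _ = length-filter≡count xs

  count-all : ∀ xs → (∀ {x} → x List.∈ xs → P x) → count xs ≡ length xs
  count-all []       all = refl
  count-all (x ∷ xs) all with P? x
  ... | yes _  = cong suc (count-all xs (all ∘ there))
  ... | no  ¬p = contradiction (all (here refl)) ¬p

  count-none : ∀ xs → (∀ {x} → x List.∈ xs → ¬ P x) → count xs ≡ 0
  count-none []       none = refl
  count-none (x ∷ xs) none with P? x
  ... | yes p = contradiction p (none (here refl))
  ... | no  _ = count-none xs (none ∘ there)

  count-unique≤1 : ∀ {xs} {b} → Unique xs → (∀ {x} → P x → x ≡ b) → count xs ≤ 1
  count-unique≤1 {[]}     []           P⇒≡b = z≤n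
  count-unique≤1 {x ∷ xs} (x∉xs ∷ uxs) P⇒≡b with P? x
  ... | no  _  = count-unique≤1 uxs P⇒≡b
  ... | yes px = ≤-reflexive (cong suc (count-none xs λ y∈xs py →
    All.lookup x∉xs y∈xs (trans (P⇒≡b px) (sym (P⇒≡b py)))))

  count-any : ∀ {xs} → Any P xs → 1 ≤ count xs
  count-any {x ∷ xs} (here px)  = ≤-trans (1≤𝟙 (P? x) px) (m≤m+n _ _)
  count-any {x ∷ xs} (there any) = ≤-trans (count-any any) (m≤n+m _ _)


count-cover : ∀ {A B : Set} {P : A → Set} (P? : Decidable P) {Q : B → A → Set} (Q? : ∀ e → Decidable (Q e))
  xs es → (∀ x → P x ⊎ Any (λ e → Q e x) es) → length xs ≤ count P? xs + ∑[ e ∈ es ] count (Q? e) xs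
count-cover {P = P} P? {Q} Q? xs es covered = begin
  length xs                                         ≡⟨ sym (*-identityʳ _) ⟩
  length xs * 1                                     ≡⟨ sym (∑-const 1 xs) ⟩
  ∑[ x ∈ xs ] 1                                     ≤⟨ ∑-mono xs (λ {x} _ → one≤ x (covered x)) ⟩
  ∑[ x ∈ xs ] (𝟙 (P? x) + ∑[ e ∈ es ] 𝟙 (Q? e x))   ≡⟨ ∑-+ _ _ xs ⟩
  count P? xs + ∑[ x ∈ xs ] ∑[ e ∈ es ] 𝟙 (Q? e x)  ≡⟨ cong (count P? xs +_) (∑-comm _ xs es) ⟩
  count P? xs + ∑[ e ∈ es ] count (Q? e) xs         ∎
  where
  open ≤-Reasoning
  one≤ : ∀ x → P x ⊎ Any (λ e → Q e x) es → 1 ≤ 𝟙 (P? x) + ∑[ e ∈ es ] 𝟙 (Q? e x)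
  one≤ x (inj₁ px)  = ≤-trans (1≤𝟙 (P? x) px) (m≤m+n _ _)
  one≤ x (inj₂ any) = ≤-trans (count-any (λ e → Q? e x) any) (m≤n+m _ _)

count-unique≤𝟙 : ∀ {A : Set} {Q : A → Set} (Q? : Decidable Q) {R : Set} (R? : Dec R) {xs b} →
  Unique xs → (∀ {x} → Q x → x ≡ b) → (∀ {x} → Q x → R) → count Q? xs ≤ 𝟙 R?
count-unique≤𝟙 Q? (yes _) uxs Q⇒≡b Q⇒R = count-unique≤1 Q? uxs Q⇒≡b
count-unique≤𝟙 Q? (no ¬r) {xs} uxs Q⇒≡b Q⇒R = ≤-reflexive (count-none Q? xs (λ _ → ¬r ∘ Q⇒R))

count-mono : ∀ {A : Set} {P Q : A → Set} (P? : Decidable P) (Q? : Decidable Q) xs →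
  (∀ {x} → P x → Q x) → count P? xs ≤ count Q? xs
count-mono P? Q? xs P⇒Q = ∑-mono xs λ {x} _ → 𝟙-mono (P? x) (Q? x) P⇒Q

-- Arithmetic

-- In the application X = P[ S - v ], Q = P[ S ] and B counts the colourings spoilt by an edge at v.
deletion-arith : ∀ c k Δ X Q B → c * X ≤ Q + B → (c * k) ^ k * B ≤ Δ * suc k ^ k * X →
  Δ * suc k ^ suc k ≤ c * (c * k) ^ k → c * k * X ≤ suc k * Q
deletion-arith c k Δ X Q B cX≤Q+B KB≤DX Δ≤cK with c * k ≟ 0
... | yes ck≡0 = subst (λ t → t * X ≤ suc k * Q) (sym ck≡0) z≤n
... | no  ck≢0 = begin
  c * k * X    ≡⟨ trans (*-assoc c k X) (x∙yz≈y∙xz c k X) ⟩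
  k * (c * X)  ≤⟨ *-cancelˡ-≤ K {{m^n≢0 (c * k) k {{≢-nonZero ck≢0}}}} (+-cancelˡ-≤ (K * Y) _ _ scaled) ⟩
  suc k * Q    ∎
  where
  open ≤-Reasoning
  K = (c * k) ^ k
  D = Δ * suc k ^ k
  Y = c * X
  scaled : K * Y + K * (k * Y) ≤ K * Y + K * (suc k * Q)
  scaled = begin
    K * Y + K * (k * Y)                      ≡⟨ *-distribˡ-+ K Y (k * Y) ⟨
    K * (suc k * Y)                          ≡⟨ x∙yz≈y∙xz K (suc k) Y ⟩
    suc k * (K * Y)                          ≤⟨ *-monoʳ-≤ (suc k) (*-monoʳ-≤ K cX≤Q+B) ⟩
    suc k * (K * (Q + B))                    ≡⟨ cong (suc k *_) (*-distribˡ-+ K Q B) ⟩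
    suc k * (K * Q + K * B)                  ≡⟨ *-distribˡ-+ (suc k) (K * Q) (K * B) ⟩
    suc k * (K * Q) + suc k * (K * B)        ≤⟨ +-monoʳ-≤ (suc k * (K * Q)) (*-monoʳ-≤ (suc k) KB≤DX) ⟩
    suc k * (K * Q) + suc k * (D * X)        ≡⟨ cong₂ _+_ (x∙yz≈y∙xz (suc k) K Q) (sym (*-assoc (suc k) D X)) ⟩
    K * (suc k * Q) + suc k * D * X          ≡⟨ cong (λ t → K * (suc k * Q) + t * X) (x∙yz≈y∙xz (suc k) Δ _) ⟩
    K * (suc k * Q) + Δ * suc k ^ suc k * X  ≤⟨ +-monoʳ-≤ (K * (suc k * Q)) (*-monoˡ-≤ X Δ≤cK) ⟩
    K * (suc k * Q) + c * K * X              ≡⟨ cong (K * (suc k * Q) +_) (*-assoc c K X) ⟩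
    K * (suc k * Q) + c * (K * X)            ≡⟨ cong (K * (suc k * Q) +_) (x∙yz≈y∙xz c K X) ⟩
    K * (suc k * Q) + K * Y                  ≡⟨ +-comm _ (K * Y) ⟩
    K * Y + K * (suc k * Q)                  ∎

^-distribʳ-* : ∀ a b n → (a * b) ^ n ≡ a ^ n * b ^ n
^-distribʳ-* a b zero    = refl
^-distribʳ-* a b (suc n) = trans (cong (a * b *_) (^-distribʳ-* a b n)) (*-interchange a b (a ^ n) (b ^ n))

^-^-comm : ∀ a m n → (a ^ m) ^ n ≡ (a ^ n) ^ m
^-^-comm a m n = trans (^-*-assoc a m n) (trans (cong (a ^_) (*-comm m n)) (sym (^-*-assoc a n m)))

power-bound : ∀ x y p m n .{{_ : NonZero m}} → x * m ^ m ≤ y ^ m → y ^ n ≤ m ^ n * p → x ^ n ≤ p ^ m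
power-bound x y p m n xmᵐ≤yᵐ yⁿ≤mⁿp =
  *-cancelʳ-≤ (x ^ n) (p ^ m) ((m ^ m) ^ n) {{m^n≢0 (m ^ m) n {{m^n≢0 m m}}}} (begin
  x ^ n * (m ^ m) ^ n  ≡⟨ ^-distribʳ-* x (m ^ m) n ⟨
  (x * m ^ m) ^ n      ≤⟨ ^-monoˡ-≤ n xmᵐ≤yᵐ ⟩
  (y ^ m) ^ n          ≡⟨ ^-^-comm y m n ⟩
  (y ^ n) ^ m          ≤⟨ ^-monoˡ-≤ m yⁿ≤mⁿp ⟩
  (m ^ n * p) ^ m      ≡⟨ ^-distribʳ-* (m ^ n) p m ⟩
  (m ^ n) ^ m * p ^ m  ≡⟨ cong (_* p ^ m) (^-^-comm m n m) ⟩
  (m ^ m) ^ n * p ^ m  ≡⟨ *-comm _ (p ^ m) ⟩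
  p ^ m * (m ^ m) ^ n  ∎)
  where open ≤-Reasoning

ceiling-bound : ∀ c k Δ .{{_ : NonZero k}} → AboveBound (2 + k) Δ c → Δ * suc k ^ suc k ≤ c * (c * k) ^ k
ceiling-bound c k Δ above = *-cancelˡ-≤ k (begin
  k * (Δ * suc k ^ suc k)  ≡⟨ *-assoc k Δ _ ⟨
  k * Δ * suc k ^ suc k    ≤⟨ above ⟩
  c * k * (c * k) ^ k      ≡⟨ trans (*-assoc c k _) (x∙yz≈y∙xz c k _) ⟩
  k * (c * (c * k) ^ k)    ∎)
  where open ≤-Reasoning

1≤m^[1+n]⇒1≤m : ∀ m n → 1 ≤ m ^ suc n → 1 ≤ m
1≤m^[1+n]⇒1≤m (suc m) n _ = s≤s z≤n

-- Subsets

x∈p─q⇒x∉q : ∀ {n} {p q : Subset n} {x} → x ∈ p ─ q → x ∉ q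
x∈p─q⇒x∉q {p = _ ∷ p} {inside  ∷ q} (there x∈) (there x∈q) = x∈p─q⇒x∉q x∈ x∈q
x∈p─q⇒x∉q {p = _ ∷ p} {outside ∷ q} (there x∈) (there x∈q) = x∈p─q⇒x∉q x∈ x∈q

x∈p-y⇒x≢y : ∀ {n} {p : Subset n} {x y} → x ∈ p - y → x ≢ y
x∈p-y⇒x≢y x∈ refl = x∈p─q⇒x∉q x∈ (x∈⁅x⁆ _)

x∈p⇒suc∣p-x∣≡∣p∣ : ∀ {n} {p : Subset n} {x} → x ∈ p → suc ∣ p - x ∣ ≡ ∣ p ∣
x∈p⇒suc∣p-x∣≡∣p∣ {p = inside  ∷ p} here       = cong suc (cong ∣_∣ (p─⊥≡p p))
x∈p⇒suc∣p-x∣≡∣p∣ {p = inside  ∷ p} (there x∈) = cong suc (x∈p⇒suc∣p-x∣≡∣p∣ x∈)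
x∈p⇒suc∣p-x∣≡∣p∣ {p = outside ∷ p} (there x∈) = x∈p⇒suc∣p-x∣≡∣p∣ x∈

elements : ∀ {n} → Subset n → List (Fin n)
elements []            = []
elements (inside  ∷ p) = zero ∷ map suc (elements p)
elements (outside ∷ p) = map suc (elements p)

∈-elements⁻ : ∀ {n} (p : Subset n) {x} → x List.∈ elements p → x ∈ p
∈-elements⁻ (inside ∷ p) (here refl) = here
∈-elements⁻ (inside ∷ p) (there x∈)
  with y , y∈ , refl ← ∈-map⁻ suc x∈ = there (∈-elements⁻ p y∈)
∈-elements⁻ (outside ∷ p) x∈
  with y , y∈ , refl ← ∈-map⁻ suc x∈ = there (∈-elements⁻ p y∈)

length-elements : ∀ {n} (p : Subset n) → length (elements p) ≡ ∣ p ∣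
length-elements []            = refl
length-elements (inside  ∷ p) = cong suc (trans (length-map suc (elements p)) (length-elements p))
length-elements (outside ∷ p) = trans (length-map suc (elements p)) (length-elements p)

elements-unique : ∀ {n} (p : Subset n) → Unique (elements p)
elements-unique []            = []
elements-unique (inside  ∷ p) = zero∉ (elements p) ∷ Unique.map⁺ Fin.suc-injective (elements-unique p)
  where
  zero∉ : ∀ {n} (xs : List (Fin n)) → All (_≢_ {A = Fin (suc n)} zero) (map suc xs)
  zero∉ []       = []
  zero∉ (x ∷ xs) = (λ ()) ∷ zero∉ xs
elements-unique (outside ∷ p) = Unique.map⁺ Fin.suc-injective (elements-unique p)

enumerate-from : ∀ {n} {e : Subset n} {v k} → v ∈ e → ∣ e ∣ ≡ suc (suc k) →
  ∃₂ λ u W → Unique (u ∷ v ∷ W) × All (_∈ e) (u ∷ v ∷ W) × length W ≡ k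
enumerate-from {e = e} {v} v∈e ∣e∣≡2+k
  with elements (e - v) | length-elements (e - v) | elements-unique (e - v) | ∈-elements⁻ (e - v)
... | []    | 0≡∣e-v∣ | _              | _    =
  contradiction (trans (cong suc 0≡∣e-v∣) (trans (x∈p⇒suc∣p-x∣≡∣p∣ v∈e) ∣e∣≡2+k)) λ ()
... | u ∷ W | len     | u∉W ∷ W-unique | ∈e-v =
  u , W , ((≢v (here refl) ∷ u∉W) ∷ All.tabulate (λ w∈ v≡w → ≢v (there w∈) (sym v≡w)) ∷ W-unique)
    , All.tabulate (λ { (here refl)         → ⊆e (here refl)
                      ; (there (here refl)) → v∈e
                      ; (there (there w∈))  → ⊆e (there w∈) })
    , suc-injective (suc-injective (trans (cong suc len) (trans (x∈p⇒suc∣p-x∣≡∣p∣ v∈e) ∣e∣≡2+k)))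
  where
  ≢v : ∀ {w} → w List.∈ u ∷ W → w ≢ v
  ≢v = x∈p-y⇒x≢y ∘ ∈e-v
  ⊆e : ∀ {w} → w List.∈ u ∷ W → w ∈ e
  ⊆e = p─q⊆p e ⁅ v ⁆ ∘ ∈e-v

_∖_ : ∀ {n} → Subset n → List (Fin n) → Subset n
_∖_ = foldl _-_

∖-⊆ : ∀ {n} (S : Subset n) D → S ∖ D ⊆ S
∖-⊆ S []      = id
∖-⊆ S (w ∷ D) = p─q⊆p S ⁅ w ⁆ ∘ ∖-⊆ (S - w) D

∈⇒∉∖ : ∀ {n} (S : Subset n) {D x} → x List.∈ D → x ∉ S ∖ D
∈⇒∉∖ S {w ∷ D} (here refl) x∈ = x∈p-y⇒x≢y (∖-⊆ (S - w) D x∈) refl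
∈⇒∉∖ S {w ∷ D} (there x∈D) x∈ = ∈⇒∉∖ (S - w) x∈D x∈

All∈-remove : ∀ {n} {S : Subset n} {w D} → Unique (w ∷ D) → All (_∈ S) D → All (_∈ S - w) D
All∈-remove (w∉D ∷ _) D⊆S = All.zipWith (λ (w≢d , d∈S) → x∈p∧x≢y⇒x∈p-y d∈S (w≢d ∘ sym)) (w∉D , D⊆S)

module _ {n} (f : Subset n → ℕ) (α β : ℕ) where

  iterate-deletion : ∀ S D → (∀ {T} → T ⊆ S → ∀ {v} → v ∈ T → α * f (T - v) ≤ β * f T) →
    Unique D → All (_∈ S) D → α ^ length D * f (S ∖ D) ≤ β ^ length D * f S
  iterate-deletion S []      step _ _ = ≤-refl
  iterate-deletion S (w ∷ D) step D-unique@(_ ∷ D′-unique) (w∈S ∷ D⊆S) = begin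
    α ^ suc l * f ((S - w) ∖ D)    ≡⟨ *-assoc α _ _ ⟩
    α * (α ^ l * f ((S - w) ∖ D))  ≤⟨ *-monoʳ-≤ α (iterate-deletion (S - w) D step′ D′-unique D⊆S-w) ⟩
    α * (β ^ l * f (S - w))        ≡⟨ x∙yz≈y∙xz α (β ^ l) _ ⟩
    β ^ l * (α * f (S - w))        ≤⟨ *-monoʳ-≤ (β ^ l) (step ⊆-refl w∈S) ⟩
    β ^ l * (β * f S)              ≡⟨ x∙yz≈y∙xz (β ^ l) β _ ⟩
    β * (β ^ l * f S)              ≡⟨ *-assoc β _ _ ⟨
    β ^ suc l * f S                ∎
    where
    open ≤-Reasoning
    l = length D
    step′ : ∀ {T} → T ⊆ S - w → ∀ {v} → v ∈ T → α * f (T - v) ≤ β * f T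
    step′ T⊆ = step (p─q⊆p S ⁅ w ⁆ ∘ T⊆)
    D⊆S-w : All (_∈ S - w) D
    D⊆S-w = All∈-remove D-unique D⊆S

-- Colourings

Colouring : ℕ → Set
Colouring n = Fin n → ℕ

_[_]≔_ : ∀ {A : Set} {n} → Vector A n → Fin n → A → Vector A n
xs [ v ]≔ a = updateAt xs v (const a)

-- Without function extensionality, `cons a y` and `cons 0 y [ zero ]≔ a` are only pointwise equal.
Extensional : ∀ {n} → (Colouring n → ℕ) → Set
Extensional f = ∀ {x y} → x ≗ y → f x ≡ f y

𝟙-ext : ∀ {n} {P : Colouring n → Set} (P? : Decidable P) →
  (∀ {x y} → x ≗ y → P x → P y) → Extensional (λ x → 𝟙 (P? x))
𝟙-ext P? resp x≗y = 𝟙-cong (P? _) (P? _) (resp x≗y) (resp (sym ∘ x≗y))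

∑-lColourings-suc : ∀ {n} (L : ListAssignment (suc n)) (f : Colouring (suc n) → ℕ) →
  ∑ (lColourings (suc n) L) f ≡ ∑[ a ∈ L zero ] ∑[ y ∈ lColourings n (L ∘ suc) ] f (cons a y)
∑-lColourings-suc {n} L f =
  trans (∑-concatMap f _ (L zero)) (∑-cong (L zero) λ a → ∑-map f (cons a) (lColourings n (L ∘ suc)))

∑-lColourings-fibre : ∀ {n} (L : ListAssignment n) v (f : Colouring n → ℕ) → Extensional f →
  ∑ (lColourings n L) f ≡ ∑[ y ∈ lColourings n (L [ v ]≔ [ 0 ]) ] ∑[ a ∈ L v ] f (y [ v ]≔ a)
∑-lColourings-fibre {suc n} L zero f f-ext = begin
  ∑ (lColourings (suc n) L) f
    ≡⟨ ∑-lColourings-suc L f ⟩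
  ∑[ a ∈ L zero ] ∑[ y ∈ Y ] f (cons a y)
    ≡⟨ ∑-comm (λ a y → f (cons a y)) (L zero) Y ⟩
  ∑[ y ∈ Y ] ∑[ a ∈ L zero ] f (cons a y)
    ≡⟨ ∑-cong Y (λ y → ∑-cong (L zero) λ a → f-ext (cons≗update a y)) ⟩
  ∑[ y ∈ Y ] ∑[ a ∈ L zero ] f (cons 0 y [ zero ]≔ a)
    ≡⟨ sym (+-identityʳ _) ⟩
  ∑[ y ∈ Y ] ∑[ a ∈ L zero ] f (cons 0 y [ zero ]≔ a) + 0
    ≡⟨ sym (∑-lColourings-suc (L [ zero ]≔ [ 0 ]) _) ⟩
  ∑[ y ∈ lColourings (suc n) (L [ zero ]≔ [ 0 ]) ] ∑[ a ∈ L zero ] f (y [ zero ]≔ a) ∎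
  where
  open ≡-Reasoning
  Y = lColourings n (L ∘ suc)
  cons≗update : ∀ a y → cons a y ≗ cons 0 y [ zero ]≔ a
  cons≗update a y zero    = refl
  cons≗update a y (suc i) = refl
∑-lColourings-fibre {suc n} L (suc v) f f-ext = begin
  ∑ (lColourings (suc n) L) f
    ≡⟨ ∑-lColourings-suc L f ⟩
  ∑[ a ∈ L zero ] ∑[ y ∈ lColourings n (L ∘ suc) ] f (cons a y)
    ≡⟨ ∑-cong (L zero) (λ a → ∑-lColourings-fibre (L ∘ suc) v (f ∘ cons a) (f-ext ∘ cons-cong a)) ⟩
  ∑[ a ∈ L zero ] ∑[ z ∈ Z ] ∑[ b ∈ L (suc v) ] f (cons a (z [ v ]≔ b))
    ≡⟨ ∑-cong (L zero) (λ a → ∑-cong Z λ z → ∑-cong (L (suc v)) λ b → f-ext (cons-update a z b)) ⟩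
  ∑[ a ∈ L zero ] ∑[ z ∈ Z ] ∑[ b ∈ L (suc v) ] f (cons a z [ suc v ]≔ b)
    ≡⟨ sym (∑-lColourings-suc (L [ suc v ]≔ [ 0 ]) _) ⟩
  ∑[ y ∈ lColourings (suc n) (L [ suc v ]≔ [ 0 ]) ] ∑[ b ∈ L (suc v) ] f (y [ suc v ]≔ b) ∎
  where
  open ≡-Reasoning
  Z = lColourings n ((L ∘ suc) [ v ]≔ [ 0 ])
  cons-cong : ∀ a {x y : Colouring n} → x ≗ y → cons a x ≗ cons a y
  cons-cong a x≗y zero    = refl
  cons-cong a x≗y (suc i) = x≗y i
  cons-update : ∀ a z b → cons a (z [ v ]≔ b) ≗ cons a z [ suc v ]≔ b
  cons-update a z b zero    = refl
  cons-update a z b (suc i) = refl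

lColourings-cong : ∀ {n} {L L′ : ListAssignment n} → L ≗ L′ → lColourings n L ≡ lColourings n L′
lColourings-cong {zero}  L≗L′ = refl
lColourings-cong {suc n} L≗L′ =
  cong₂ (λ l Y → concatMap (λ a → map (cons a) Y) l) (L≗L′ zero) (lColourings-cong (L≗L′ ∘ suc))

lColourings-nonempty : ∀ {n} (L : ListAssignment n) → (∀ v → 1 ≤ length (L v)) → 1 ≤ length (lColourings n L)
lColourings-nonempty {zero}  L nonempty = ≤-refl
lColourings-nonempty {suc n} L nonempty with L zero | nonempty zero
... | a ∷ as | _ = begin
  1                                                   ≤⟨ lColourings-nonempty (L ∘ suc) (nonempty ∘ suc) ⟩
  length Y                                            ≡⟨ sym (length-map (cons a) Y) ⟩
  length (map (cons a) Y)                             ≤⟨ length-++-≤ˡ (map (cons a) Y) ⟩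
  length (concatMap (λ b → map (cons b) Y) (a ∷ as))  ∎
  where
  open ≤-Reasoning
  Y = lColourings n (L ∘ suc)

∈-lColourings⁻ : ∀ {n} (L : ListAssignment n) {x} → x List.∈ lColourings n L → IsLColouring L x
∈-lColourings⁻ {suc n} L x∈ v
  with a , a∈ , x∈′ ← find (∈-concatMap⁻ (λ a → map (cons a) (lColourings n (L ∘ suc))) {xs = L zero} x∈)
  with y , y∈ , refl ← ∈-map⁻ (cons a) x∈′
  with v
... | zero  = a∈
... | suc w = ∈-lColourings⁻ (L ∘ suc) y∈ w

-- Vertices outside S get the single dummy colour 0, so colourings of S are still functions on Fin n.
palette : Side → List ℕ → List ℕ
palette inside  l = l
palette outside l = [ 0 ]

_↾_ : ∀ {n} → ListAssignment n → Subset n → ListAssignment n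
(L ↾ (s ∷ S)) zero    = palette s (L zero)
(L ↾ (s ∷ S)) (suc v) = ((L ∘ suc) ↾ S) v

↾-∈ : ∀ {n} (L : ListAssignment n) {S v} → v ∈ S → (L ↾ S) v ≡ L v
↾-∈ L here       = refl
↾-∈ L (there v∈) = ↾-∈ (L ∘ suc) v∈

↾-∉ : ∀ {n} (L : ListAssignment n) {S} v → v ∉ S → (L ↾ S) v ≡ [ 0 ]
↾-∉ L {inside  ∷ S} zero    v∉ = contradiction here v∉
↾-∉ L {outside ∷ S} zero    v∉ = refl
↾-∉ L {s ∷ S}       (suc v) v∉ = ↾-∉ (L ∘ suc) v (v∉ ∘ there)

↾-⊤ : ∀ {n} (L : ListAssignment n) → L ↾ ⊤ ≗ L
↾-⊤ L zero    = refl
↾-⊤ L (suc v) = ↾-⊤ (L ∘ suc) v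

↾-remove : ∀ {n} (L : ListAssignment n) S v → L ↾ (S - v) ≗ (L ↾ S) [ v ]≔ [ 0 ]
↾-remove L (s ∷ S) zero    zero    = refl
↾-remove L (s ∷ S) zero    (suc w) = cong (λ T → ((L ∘ suc) ↾ T) w) (p─⊥≡p S)
↾-remove L (s ∷ S) (suc v) zero    = refl
↾-remove L (s ∷ S) (suc v) (suc w) = ↾-remove (L ∘ suc) S v w

monochromatic-agree : ∀ {n} {x y : Colouring n} {e} → (∀ {i} → i ∈ e → x i ≡ y i) →
  Monochromatic x e → Monochromatic y e
monochromatic-agree x≈y mono u w u∈ w∈ = trans (sym (x≈y u∈)) (trans (mono u w u∈ w∈) (x≈y w∈))

-- Counting proper colourings of induced subhypergraphs

module Counting {n} (G : Hypergraph n) (L : ListAssignment n) where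

  ProperOn : Subset n → Colouring n → Set
  ProperOn S x = All (λ e → e ⊆ S → ¬ Monochromatic x e) (edges G)

  properOn? : ∀ S → Decidable (ProperOn S)
  properOn? S x = All.all? (λ e → (e ⊆? S) →-dec ¬? (monochromatic? x e)) (edges G)

  ProperOn-agree : ∀ {S x y} → (∀ {i} → i ∈ S → x i ≡ y i) → ProperOn S x → ProperOn S y
  ProperOn-agree x≈y = All.map λ ¬mono e⊆S → ¬mono e⊆S ∘ monochromatic-agree (λ i∈ → sym (x≈y (e⊆S i∈)))

  ProperOn-⊆ : ∀ {S T x} → T ⊆ S → ProperOn S x → ProperOn T x
  ProperOn-⊆ T⊆S = All.map λ ¬mono e⊆T → ¬mono (T⊆S ∘ e⊆T)

  colourings : Subset n → List (Colouring n)
  colourings S = lColourings n (L ↾ S)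

  P[_] : Subset n → ℕ
  P[ S ] = count (properOn? S) (colourings S)

  ∑-fibre : ∀ {S v} → v ∈ S → (f : Colouring n → ℕ) → Extensional f →
    ∑ (colourings S) f ≡ ∑[ y ∈ colourings (S - v) ] ∑[ a ∈ L v ] f (y [ v ]≔ a)
  ∑-fibre {S} {v} v∈S f f-ext = begin
    ∑ (colourings S) f
      ≡⟨ ∑-lColourings-fibre (L ↾ S) v f f-ext ⟩
    ∑[ y ∈ lColourings n ((L ↾ S) [ v ]≔ [ 0 ]) ] ∑[ a ∈ (L ↾ S) v ] f (y [ v ]≔ a)
      ≡⟨ cong₂ (λ Y l → ∑[ y ∈ Y ] ∑[ a ∈ l ] f (y [ v ]≔ a))
               (lColourings-cong (sym ∘ ↾-remove L S v)) (↾-∈ L v∈S) ⟩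
    ∑[ y ∈ colourings (S - v) ] ∑[ a ∈ L v ] f (y [ v ]≔ a) ∎
    where open ≡-Reasoning

  edgesAt : Fin n → List (Subset n)
  edgesAt v = filter (v ∈?_) (edges G)

  Bad : Subset n → Fin n → Subset n → Colouring n → Set
  Bad S v e x = ProperOn (S - v) x × e ⊆ S × Monochromatic x e

  bad? : ∀ S v e → Decidable (Bad S v e)
  bad? S v e x = properOn? (S - v) x ×-dec (e ⊆? S) ×-dec monochromatic? x e

  #Bad : Subset n → Fin n → Subset n → ℕ
  #Bad S v e = count (bad? S v e) (colourings S)

  recolour-proper-or-bad : ∀ {S v y} → ProperOn (S - v) y → ∀ a →
    ProperOn S (y [ v ]≔ a) ⊎ Any (λ e → Bad S v e (y [ v ]≔ a)) (edgesAt v)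
  recolour-proper-or-bad {S} {v} {y} y-proper a
    with Any.any? (λ e → bad? S v e (y [ v ]≔ a)) (edgesAt v)
  ... | yes bad = inj₂ bad
  ... | no ¬bad = inj₁ (All.tabulate λ e∈ e⊆S mono →
    ¬bad (lose (∈-filter⁺ (v ∈?_) e∈ (v∈e e∈ e⊆S mono)) (y′-proper , e⊆S , mono)))
    where
    y′ = y [ v ]≔ a
    agree : ∀ {i} → i ≢ v → y i ≡ y′ i
    agree i≢v = sym (updateAt-minimal _ v y i≢v)
    y′-proper : ProperOn (S - v) y′
    y′-proper = ProperOn-agree (agree ∘ x∈p-y⇒x≢y) y-proper
    v∈e : ∀ {e} → e List.∈ edges G → e ⊆ S → Monochromatic y′ e → v ∈ e
    v∈e {e} e∈ e⊆S mono = decidable-stable (v ∈? e) λ v∉e →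
      let ≢v : ∀ {i} → i ∈ e → i ≢ v
          ≢v i∈ i≡v = v∉e (subst (_∈ e) i≡v i∈)
      in All.lookup y-proper e∈ (λ i∈ → x∈p∧x≢y⇒x∈p-y (e⊆S i∈) (≢v i∈))
                                (monochromatic-agree (λ i∈ → sym (agree (≢v i∈))) mono)

  properOn-ext : ∀ S → Extensional (λ x → 𝟙 (properOn? S x))
  properOn-ext S = 𝟙-ext (properOn? S) λ x≗y → ProperOn-agree (λ {i} _ → x≗y i)

  bad-ext : ∀ S v e → Extensional (λ x → 𝟙 (bad? S v e x))
  bad-ext S v e = 𝟙-ext (bad? S v e) λ x≗y (proper , e⊆S , mono) →
    ProperOn-agree (λ {i} _ → x≗y i) proper , e⊆S , monochromatic-agree (λ {i} _ → x≗y i) mono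

  deletion-inequality : ∀ {S v} → v ∈ S →
    length (L v) * P[ S - v ] ≤ P[ S ] + ∑[ e ∈ edgesAt v ] #Bad S v e
  deletion-inequality {S} {v} v∈S = begin
    length (L v) * P[ S - v ]
      ≡⟨ sym (∑-*ˡ (length (L v)) _ Y) ⟩
    ∑[ y ∈ Y ] (length (L v) * 𝟙 (properOn? (S - v) y))
      ≤⟨ ∑-mono Y (λ {y} _ → pointwise y) ⟩
    ∑[ y ∈ Y ] (good y + ∑[ e ∈ edgesAt v ] bad e y)
      ≡⟨ ∑-+ good _ Y ⟩
    ∑ Y good + ∑[ y ∈ Y ] ∑[ e ∈ edgesAt v ] bad e y
      ≡⟨ cong₂ _+_ (sym (∑-fibre v∈S _ (properOn-ext S))) (∑-comm _ Y (edgesAt v)) ⟩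
    P[ S ] + ∑[ e ∈ edgesAt v ] ∑ Y (bad e)
      ≡⟨ cong (P[ S ] +_) (∑-cong (edgesAt v) λ e → sym (∑-fibre v∈S _ (bad-ext S v e))) ⟩
    P[ S ] + ∑[ e ∈ edgesAt v ] #Bad S v e ∎
    where
    open ≤-Reasoning
    Y = colourings (S - v)
    good : Colouring n → ℕ
    good y = count (properOn? S ∘ (y [ v ]≔_)) (L v)
    bad : Subset n → Colouring n → ℕ
    bad e y = count (bad? S v e ∘ (y [ v ]≔_)) (L v)
    pointwise : ∀ y → length (L v) * 𝟙 (properOn? (S - v) y) ≤ good y + ∑[ e ∈ edgesAt v ] bad e y
    pointwise y with properOn? (S - v) y
    ... | no _ = ≤-trans (≤-reflexive (*-zeroʳ (length (L v)))) z≤n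
    ... | yes y-proper = ≤-trans (≤-reflexive (*-identityʳ (length (L v))))
      (count-cover (properOn? S ∘ (y [ v ]≔_)) (λ e → bad? S v e ∘ (y [ v ]≔_)) (L v) (edgesAt v)
                   (recolour-proper-or-bad y-proper))

  Forced : Subset n → List (Fin n) → Fin n → Colouring n → Set
  Forced S D u x = ProperOn (S ∖ D) x × All (λ d → x d ≡ x u) D

  forced? : ∀ S D u → Decidable (Forced S D u)
  forced? S D u x = properOn? (S ∖ D) x ×-dec All.all? (λ d → x d ≟ x u) D

  forced-ext : ∀ S D u → Extensional (λ x → 𝟙 (forced? S D u x))
  forced-ext S D u = 𝟙-ext (forced? S D u) λ x≗y (proper , D-forced) →
    ProperOn-agree (λ {i} _ → x≗y i) proper ,
    All.map (λ {d} eq → trans (sym (x≗y d)) (trans eq (x≗y u))) D-forced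

  -- A colouring in which every vertex of D copies the colour of u ∉ D is determined by its
  -- restriction to S ∖ D.
  count-forced : (∀ w → Unique (L w)) → ∀ S D {u} → Unique D → All (_∈ S) D → All (u ≢_) D →
    count (forced? S D u) (colourings S) ≤ P[ S ∖ D ]
  count-forced L-unique S [] {u} _ _ _ = count-mono (forced? S [] u) (properOn? S) (colourings S) proj₁
  count-forced L-unique S (w ∷ D) {u} D-unique@(w∉D ∷ D′-unique) (w∈S ∷ D⊆S) (u≢w ∷ u∉D) = begin
    count (forced? S (w ∷ D) u) (colourings S)
      ≡⟨ ∑-fibre w∈S _ (forced-ext S (w ∷ D) u) ⟩
    ∑[ y ∈ colourings (S - w) ] count (forced? S (w ∷ D) u ∘ (y [ w ]≔_)) (L w)
      ≤⟨ ∑-mono (colourings (S - w)) (λ {y} _ → fibre≤ y) ⟩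
    count (forced? (S - w) D u) (colourings (S - w))
      ≤⟨ count-forced L-unique (S - w) D D′-unique (All∈-remove D-unique D⊆S) u∉D ⟩
    P[ (S - w) ∖ D ] ∎
    where
    open ≤-Reasoning
    unchanged : ∀ y {a i} → i ≢ w → (y [ w ]≔ a) i ≡ y i
    unchanged y i≢w = updateAt-minimal _ w y i≢w
    colour-of-w : ∀ y {a} → Forced S (w ∷ D) u (y [ w ]≔ a) → a ≡ y u
    colour-of-w y (_ , yw≡yu ∷ _) = trans (sym (updateAt-updates w y)) (trans yw≡yu (unchanged y u≢w))
    forced-remove : ∀ y {a} → Forced S (w ∷ D) u (y [ w ]≔ a) → Forced (S - w) D u y
    forced-remove y (proper , _ ∷ D-forced) =
      ProperOn-agree (λ i∈ → unchanged y (x∈p-y⇒x≢y (∖-⊆ (S - w) D i∈))) proper ,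
      All.zipWith (λ (w≢d , eq) → trans (sym (unchanged y (w≢d ∘ sym))) (trans eq (unchanged y u≢w)))
                  (w∉D , D-forced)
    fibre≤ : ∀ y → count (forced? S (w ∷ D) u ∘ (y [ w ]≔_)) (L w) ≤ 𝟙 (forced? (S - w) D u y)
    fibre≤ y = count-unique≤𝟙 (forced? S (w ∷ D) u ∘ (y [ w ]≔_)) (forced? (S - w) D u y)
                              (L-unique w) (colour-of-w y) (forced-remove y)

  P[⊤]≡P : P[ ⊤ ] ≡ P G L
  P[⊤]≡P = begin
    count (properOn? ⊤) (colourings ⊤)           ≡⟨ cong (count (properOn? ⊤)) (lColourings-cong (↾-⊤ L)) ⟩
    count (properOn? ⊤) (lColourings n L)        ≡⟨ ∑-cong (lColourings n L) proper⊤⇔proper ⟩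
    count (proper? G) (lColourings n L)          ≡⟨ length-filter≡count (proper? G) (lColourings n L) ⟨
    P G L                                        ∎
    where
    open ≡-Reasoning
    proper⊤⇔proper : ∀ x → 𝟙 (properOn? ⊤ x) ≡ 𝟙 (proper? G x)
    proper⊤⇔proper x = 𝟙-cong (properOn? ⊤ x) (proper? G x)
      (All.map λ ¬mono → ¬mono λ _ → ∈⊤) (All.map λ ¬mono _ → ¬mono)

module Bounds {n} (G : Hypergraph n) (L : ListAssignment n) {c k Δ : ℕ}
  (L-c : IsCListAssignment c L) (uniform : Uniform (suc (suc k)) G) (deg≤Δ : ∀ v → degree G v ≤ Δ)
  (Δ≤c[ck]ᵏ : Δ * suc k ^ suc k ≤ c * (c * k) ^ k) where

  open Counting G L

  DeletionBound : Subset n → Set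
  DeletionBound S = ∀ {v} → v ∈ S → c * k * P[ S - v ] ≤ suc k * P[ S ]

  bad-bound : ∀ {S v e} → e List.∈ edges G → v ∈ e → (∀ {T} → T ⊆ S - v → DeletionBound T) →
    (c * k) ^ k * #Bad S v e ≤ suc k ^ k * P[ S - v ]
  -- A plain `with e ⊆? S` would also abstract the copy of this decision inside bad?.
  bad-bound {S} {v} {e} e∈ v∈e IH with toSum (e ⊆? S)
  ... | inj₂ e⊈S = begin
    (c * k) ^ k * #Bad S v e  ≡⟨ cong ((c * k) ^ k *_) no-bad ⟩
    (c * k) ^ k * 0           ≡⟨ *-zeroʳ ((c * k) ^ k) ⟩
    0                         ≤⟨ z≤n ⟩
    suc k ^ k * P[ S - v ]    ∎
    where
    open ≤-Reasoning
    no-bad : #Bad S v e ≡ 0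
    no-bad = count-none (bad? S v e) (colourings S) λ _ (_ , e⊆S , _) → e⊈S e⊆S
  ... | inj₁ e⊆S
    with u , W , (u∉vW ∷ vW-unique) , (u∈e ∷ v∈e ∷ W⊆e) , |W|≡k
           ← enumerate-from v∈e (All.lookup uniform e∈) = begin
    (c * k) ^ k * #Bad S v e                 ≤⟨ *-monoʳ-≤ ((c * k) ^ k) bad≤ ⟩
    (c * k) ^ k * P[ (S - v) ∖ W ]           ≡⟨ cong (λ j → (c * k) ^ j * P[ (S - v) ∖ W ]) |W|≡k ⟨
    (c * k) ^ length W * P[ (S - v) ∖ W ]    ≤⟨ delete-W ⟩
    suc k ^ length W * P[ S - v ]            ≡⟨ cong (λ j → suc k ^ j * P[ S - v ]) |W|≡k ⟩
    suc k ^ k * P[ S - v ]                   ∎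
    where
    open ≤-Reasoning
    L-unique : ∀ w → Unique (L w)
    L-unique = proj₁ ∘ L-c
    vW⊆S : All (_∈ S) (v ∷ W)
    vW⊆S = All.map (λ i∈e → e⊆S i∈e) (v∈e ∷ W⊆e)
    W-unique : Unique W
    W-unique = AllPairs.tail vW-unique
    W⊆S-v : All (_∈ S - v) W
    W⊆S-v = All∈-remove vW-unique (All.tail vW⊆S)
    bad⇒forced : ∀ {x} → Bad S v e x → Forced S (v ∷ W) u x
    bad⇒forced (proper , _ , mono) =
      ProperOn-⊆ (∖-⊆ (S - v) W) proper , All.map (λ d∈e → mono _ _ d∈e u∈e) (v∈e ∷ W⊆e)
    delete-W : (c * k) ^ length W * P[ (S - v) ∖ W ] ≤ suc k ^ length W * P[ S - v ]
    delete-W = iterate-deletion P[_] (c * k) (suc k) (S - v) W IH W-unique W⊆S-v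
    bad≤ : #Bad S v e ≤ P[ (S - v) ∖ W ]
    bad≤ = ≤-trans (count-mono (bad? S v e) (forced? S (v ∷ W) u) (colourings S) bad⇒forced)
                   (count-forced L-unique S (v ∷ W) vW-unique vW⊆S u∉vW)

  deletion-bound : ∀ S → DeletionBound S
  deletion-bound = WF.All.wfRec ⊂-wellFounded _ DeletionBound step
    where
    step : ∀ S → (∀ {T} → T ⊂ S → DeletionBound T) → DeletionBound S
    step S IH {v} v∈S = deletion-arith c k Δ P[ S - v ] P[ S ] (∑ (edgesAt v) (#Bad S v))
      (subst (λ l → l * P[ S - v ] ≤ _) (proj₂ (L-c v)) (deletion-inequality v∈S)) bad-sum Δ≤c[ck]ᵏ
      where
      open ≤-Reasoning
      bad-sum : (c * k) ^ k * ∑ (edgesAt v) (#Bad S v) ≤ Δ * suc k ^ k * P[ S - v ]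
      bad-sum = begin
        (c * k) ^ k * ∑ (edgesAt v) (#Bad S v)        ≡⟨ ∑-*ˡ ((c * k) ^ k) (#Bad S v) (edgesAt v) ⟨
        ∑[ e ∈ edgesAt v ] ((c * k) ^ k * #Bad S v e)  ≤⟨ ∑-mono (edgesAt v) per-edge ⟩
        ∑[ e ∈ edgesAt v ] (suc k ^ k * P[ S - v ])    ≡⟨ ∑-const _ (edgesAt v) ⟩
        degree G v * (suc k ^ k * P[ S - v ])          ≤⟨ *-monoˡ-≤ _ (deg≤Δ v) ⟩
        Δ * (suc k ^ k * P[ S - v ])                   ≡⟨ *-assoc Δ _ _ ⟨
        Δ * suc k ^ k * P[ S - v ]                     ∎
        where
        per-edge : ∀ {e} → e List.∈ edgesAt v → (c * k) ^ k * #Bad S v e ≤ suc k ^ k * P[ S - v ]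
        per-edge e∈ = let e∈G , v∈e = ∈-filter⁻ (v ∈?_) e∈ in
          bad-bound e∈G v∈e λ T⊆S-v → IH (⊆-⊂-trans T⊆S-v (x∈p⇒p-x⊂p v∈S))

  1≤P[⊥] : 1 ≤ P[ ⊥ ]
  1≤P[⊥] = begin
    1                      ≤⟨ lColourings-nonempty (L ↾ ⊥) (λ v → ≤-reflexive (cong length (sym (↾-∉ L v ∉⊥)))) ⟩
    length (colourings ⊥)  ≡⟨ count-all (properOn? ⊥) (colourings ⊥) (λ _ → all-proper) ⟨
    P[ ⊥ ]                 ∎
    where
    open ≤-Reasoning
    e⊈⊥ : ∀ {e} → e List.∈ edges G → ¬ e ⊆ ⊥
    e⊈⊥ {e} e∈ e⊆⊥ with () ← begin-strict
      0              <⟨ s≤s z≤n ⟩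
      suc (suc k)    ≡⟨ All.lookup uniform e∈ ⟨
      ∣ e ∣          ≤⟨ p⊆q⇒∣p∣≤∣q∣ e⊆⊥ ⟩
      ∣ ⊥ {n = n} ∣  ≡⟨ ∣⊥∣≡0 n ⟩
      0              ∎
    all-proper : ∀ {x} → ProperOn ⊥ x
    all-proper = All.tabulate λ e∈ e⊆⊥ _ → e⊈⊥ e∈ e⊆⊥

  main-bound : (c * k) ^ n ≤ suc k ^ n * P G L
  main-bound = begin
    (c * k) ^ n                                      ≡⟨ *-identityʳ ((c * k) ^ n) ⟨
    (c * k) ^ n * 1                                  ≤⟨ *-monoʳ-≤ ((c * k) ^ n) 1≤P[⊥] ⟩
    (c * k) ^ n * P[ ⊥ ]                             ≡⟨ cong₂ (λ j R → (c * k) ^ j * P[ R ]) |V|≡n ⊤∖all≡⊥ ⟨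
    (c * k) ^ length (allFin n) * P[ ⊤ ∖ allFin n ]  ≤⟨ iterate-deletion P[_] (c * k) (suc k) ⊤ (allFin n)
                                                          (λ _ → deletion-bound _) (Unique.allFin⁺ n) V⊆⊤ ⟩
    suc k ^ length (allFin n) * P[ ⊤ ]               ≡⟨ cong₂ (λ j t → suc k ^ j * t) |V|≡n P[⊤]≡P ⟩
    suc k ^ n * P G L                                ∎
    where
    open ≤-Reasoning
    |V|≡n : length (allFin n) ≡ n
    |V|≡n = length-tabulate id
    V⊆⊤ : All (_∈ ⊤) (allFin n)
    V⊆⊤ = All.tabulate λ _ → ∈⊤
    ⊤∖all≡⊥ : ⊤ ∖ allFin n ≡ ⊥
    ⊤∖all≡⊥ = Empty-unique λ (v , v∈) → ∈⇒∉∖ ⊤ (∈-allFin v) v∈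

proper-L-colouring : ∀ {n} (G : Hypergraph n) L → 1 ≤ P G L →
  Σ (Fin n → ℕ) λ φ → IsLColouring L φ × Proper G φ
proper-L-colouring {n} G L 1≤P with filter (proper? G) (lColourings n L) in eq | 1≤P
... | φ ∷ _ | _ with φ∈ , proper ← ∈-filter⁻ (proper? G) (subst (φ List.∈_) (sym eq) (here refl)) =
  φ , ∈-lColourings⁻ L φ∈ , proper

theorem2 : ∀ (r Δ n c : ℕ) → r ≥ 3 → Δ ≥ 1 →
    (G : Hypergraph n) → Uniform r G → MaxDegree G Δ →
    IsCeilBound r Δ c →
    ChoosabilityAtMost G c ×
      (∀ (L : ListAssignment n) → IsCListAssignment c L →
        P G L ^ (r ∸ 1) ≥ ((r ∸ 2) * Δ) ^ n)
theorem2 (suc (suc k@(suc _))) Δ n c (s≤s (s≤s (s≤s _))) Δ≥1 G uniform (deg≤Δ , _) (above , _) =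
  (c , ≤-refl , choosable) , count-bound
  where
  count-bound : ∀ L → IsCListAssignment c L → P G L ^ suc k ≥ (k * Δ) ^ n
  count-bound L L-c = power-bound (k * Δ) (c * k) (P G L) (suc k) n above
    (Bounds.main-bound G L L-c uniform deg≤Δ (ceiling-bound c k Δ above))
  choosable : Choosable G c
  choosable L L-c = proper-L-colouring G L (1≤m^[1+n]⇒1≤m (P G L) k (≤-trans 1≤[kΔ]ⁿ (count-bound L L-c)))
    where
    1≤[kΔ]ⁿ : 1 ≤ (k * Δ) ^ n
    1≤[kΔ]ⁿ = m^n>0 (k * Δ) {{m*n≢0 k Δ {{_}} {{>-nonZero Δ≥1}}}} n
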